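{- Let $r\ge 1$ be an integer, let $g\in\mathbb{F}_2^r$, and suppose that $A\subseteq\mathbb{F}_2^r$ satisfies $|A|\ge 2$. Then $\Gamma(A)$ has a spanning star with center at $g$ (that is, $g\in A$ and $g$ is adjacent in $\Gamma(A)$ to every other element of $A$) if and only if $A=g+(S\cup\{0\})$ for some sum-free set $S\subseteq\mathbb{F}_2^r$.
   Context: $\mathbb{F}_2^r$ denotes the elementary abelian $2$-group of rank $r$. For $X\subseteq\mathbb{F}_2^r$, $2X:=\{x_1+x_2\colon x_1,x_2\in X\}$ (with $x_1=x_2$ allowed) and $g+X:=\{g+x\colon x\in X\}$; $S$ is sum-free if $S\cap 2S=\varnothing$. For $A\subseteq\mathbb{F}_2^r$, $D(A)$ is the set of elements of $\mathbb{F}_2^r$ having exactly one representation, up to the order of summands, as $a_1+a_2$ with $a_1,a_2\in A$. The unique representation graph $\Gamma(A)$ is the graph with vertex set $A$ in which distinct $a_1,a_2\in A$ are adjacent iff $a_1+a_2\in D(A)$. -}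

module Defs where

open import Data.Bool using (Bool; false; _xor_)
open import Data.Nat using (ℕ)
open import Data.Vec using (Vec; zipWith; replicate)
open import Data.Product using (Σ; _×_; _,_; ∃)
open import Data.Sum using (_⊎_)
open import Relation.Binary.PropositionalEquality using (_≡_)
open import Relation.Nullary using (¬_)
open import Level using (0ℓ)
open import Relation.Unary using (Pred; _∈_)

F₂^ : ℕ → Set
F₂^ r = Vec Bool r

_⊕_ : ∀ {r} → F₂^ r → F₂^ r → F₂^ r
_⊕_ = zipWith _xor_

𝟎 : ∀ {r} → F₂^ r
𝟎 {r} = replicate r false

Subset : ℕ → Set₁
Subset r = Pred (F₂^ r) 0ℓ

_∈2_ : ∀ {r} → F₂^ r → Subset r → Set
x ∈2 X = ∃ λ x₁ → ∃ λ x₂ → x₁ ∈ X × x₂ ∈ X × x₁ ⊕ x₂ ≡ x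

SumFree : ∀ {r} → Subset r → Set
SumFree S = ∀ s → s ∈ S → ¬ (s ∈2 S)

SamePair : ∀ {r} → F₂^ r → F₂^ r → F₂^ r → F₂^ r → Set
SamePair a₁ a₂ b₁ b₂ = (a₁ ≡ b₁ × a₂ ≡ b₂) ⊎ (a₁ ≡ b₂ × a₂ ≡ b₁)

InD : ∀ {r} → Subset r → F₂^ r → Set
InD A x = ∃ λ a₁ → ∃ λ a₂ → a₁ ∈ A × a₂ ∈ A × a₁ ⊕ a₂ ≡ x ×
  (∀ b₁ b₂ → b₁ ∈ A → b₂ ∈ A → b₁ ⊕ b₂ ≡ x → SamePair a₁ a₂ b₁ b₂)

-- adjacency in the unique representation graph Γ(A)
Adj : ∀ {r} → Subset r → F₂^ r → F₂^ r → Set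
Adj A a₁ a₂ = a₁ ∈ A × a₂ ∈ A × ¬ (a₁ ≡ a₂) × InD A (a₁ ⊕ a₂)

SpanningStar : ∀ {r} → Subset r → F₂^ r → Set
SpanningStar A g = g ∈ A × (∀ a → a ∈ A → ¬ (a ≡ g) → Adj A g a)

Translate : ∀ {r} → F₂^ r → Subset r → Subset r
Translate g X y = ∃ λ x → x ∈ X × y ≡ g ⊕ x

WithZero : ∀ {r} → Subset r → Subset r
WithZero S x = x ∈ S ⊎ x ≡ 𝟎

_≐_ : ∀ {r} → Subset r → Subset r → Set
A ≐ B = ∀ x → (x ∈ A → x ∈ B) × (x ∈ B → x ∈ A)

AtLeastTwo : ∀ {r} → Subset r → Set
AtLeastTwo A = ∃ λ a → ∃ λ b → a ∈ A × b ∈ A × ¬ (a ≡ b)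

module Submission where

-- Translating by g is an automorphism of everything in sight:
-- (g + a₁) + (g + a₂) = a₁ + a₂ in F₂^r, so x ↦ g + x carries
-- representations of a sum in A bijectively to representations of the
-- same sum in g + A.  Hence Γ(A) has a spanning star at g iff Γ(g + A) has
-- one at 0, and it suffices to treat centre 0.  There, with 0 ∈ B and
-- S = B ∖ {0}, a vertex s ∈ S has the representation s = 0 + s, and any
-- other one avoids 0, i.e. lies in 2S; so 0 is adjacent to every s ∈ S
-- exactly when S is sum-free.

open import Defs
open import Data.Nat using (ℕ; _≥_)
open import Data.Bool.Properties
  using (xor-assoc; xor-comm; xor-identityʳ; xor-same)
  renaming (_≟_ to _≟ᴮ_)
open import Data.Vec using ([]; _∷_)
open import Data.Vec.Properties using (≡-dec)
open import Data.Product using (Σ; _×_; _,_; proj₁; proj₂)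
open import Data.Sum using (inj₁; inj₂)
open import Data.Empty using (⊥-elim)
open import Function.Bundles using (_⇔_; mk⇔)
open import Relation.Nullary using (¬_; yes; no)
open import Relation.Unary using (_∈_)
open import Relation.Binary.PropositionalEquality
  using (_≡_; refl; sym; trans; cong; cong₂; subst; module ≡-Reasoning)

private
  variable
    r : ℕ

⊕-assoc : (x y z : F₂^ r) → (x ⊕ y) ⊕ z ≡ x ⊕ (y ⊕ z)
⊕-assoc []      []      []      = refl
⊕-assoc (a ∷ x) (b ∷ y) (c ∷ z) = cong₂ _∷_ (xor-assoc a b c) (⊕-assoc x y z)

⊕-comm : (x y : F₂^ r) → x ⊕ y ≡ y ⊕ x
⊕-comm []      []      = refl
⊕-comm (a ∷ x) (b ∷ y) = cong₂ _∷_ (xor-comm a b) (⊕-comm x y)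

⊕-identityˡ : (x : F₂^ r) → 𝟎 ⊕ x ≡ x
⊕-identityˡ []      = refl
⊕-identityˡ (a ∷ x) = cong (a ∷_) (⊕-identityˡ x)

⊕-identityʳ : (x : F₂^ r) → x ⊕ 𝟎 ≡ x
⊕-identityʳ []      = refl
⊕-identityʳ (a ∷ x) = cong₂ _∷_ (xor-identityʳ a) (⊕-identityʳ x)

⊕-self : (x : F₂^ r) → x ⊕ x ≡ 𝟎
⊕-self []      = refl
⊕-self (a ∷ x) = cong₂ _∷_ (xor-same a) (⊕-self x)

shift-involutive : (g x : F₂^ r) → g ⊕ (g ⊕ x) ≡ x
shift-involutive g x = begin
  g ⊕ (g ⊕ x)  ≡⟨ sym (⊕-assoc g g x) ⟩
  (g ⊕ g) ⊕ x  ≡⟨ cong (_⊕ x) (⊕-self g) ⟩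
  𝟎 ⊕ x        ≡⟨ ⊕-identityˡ x ⟩
  x            ∎
  where open ≡-Reasoning

shift-pair : (g x y : F₂^ r) → (g ⊕ x) ⊕ (g ⊕ y) ≡ x ⊕ y
shift-pair g x y = begin
  (g ⊕ x) ⊕ (g ⊕ y)  ≡⟨ cong (_⊕ (g ⊕ y)) (⊕-comm g x) ⟩
  (x ⊕ g) ⊕ (g ⊕ y)  ≡⟨ ⊕-assoc x g (g ⊕ y) ⟩
  x ⊕ (g ⊕ (g ⊕ y))  ≡⟨ cong (x ⊕_) (shift-involutive g y) ⟩
  x ⊕ y              ∎
  where open ≡-Reasoning

shift-transpose : {g a b : F₂^ r} → g ⊕ a ≡ b → a ≡ g ⊕ b
shift-transpose {g = g} {a} refl = sym (shift-involutive g a)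

shift-untranspose : {g a b : F₂^ r} → a ≡ g ⊕ b → g ⊕ a ≡ b
shift-untranspose e = sym (shift-transpose (sym e))

shift-injective : {g a b : F₂^ r} → g ⊕ a ≡ g ⊕ b → a ≡ b
shift-injective {g = g} {b = b} e = trans (shift-transpose e) (shift-involutive g b)

-- The translate g + X, described by its membership condition
-- x ∈ g + X ⇔ g + x ∈ X (Translate≐Shift below compares it with Defs).
Shift : F₂^ r → Subset r → Subset r
Shift g X x = X (g ⊕ x)

shift-member : {g a : F₂^ r} (X : Subset r) → X a → Shift g X (g ⊕ a)
shift-member {g = g} {a} X = subst X (sym (shift-involutive g a))

≐-sym : {X Y : Subset r} → X ≐ Y → Y ≐ X
≐-sym X≐Y x = let (to , from) = X≐Y x in from , to

≐-trans : {X Y Z : Subset r} → X ≐ Y → Y ≐ Z → X ≐ Z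
≐-trans X≐Y Y≐Z x =
  let (to₁ , from₁) = X≐Y x ; (to₂ , from₂) = Y≐Z x
  in (λ m → to₂ (to₁ m)) , (λ m → from₁ (from₂ m))

Shift-involutive : (g : F₂^ r) (X : Subset r) → Shift g (Shift g X) ≐ X
Shift-involutive g X x =
  subst X (shift-involutive g x) , subst X (sym (shift-involutive g x))

Shift-resp-≐ : (g : F₂^ r) {X Y : Subset r} → X ≐ Y → Shift g X ≐ Shift g Y
Shift-resp-≐ g X≐Y x = X≐Y (g ⊕ x)

Translate≐Shift : (g : F₂^ r) (X : Subset r) → Translate g X ≐ Shift g X
Translate≐Shift g X y =
  (λ { (x , xX , e) → subst X (sym (shift-untranspose e)) xX }) ,
  (λ yX → g ⊕ y , yX , sym (shift-involutive g y))

InD-resp-≐ : {A B : Subset r} {x : F₂^ r} → A ≐ B → InD A x → InD B x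
InD-resp-≐ A≐B (a₁ , a₂ , m₁ , m₂ , e , unique) =
  a₁ , a₂ , proj₁ (A≐B a₁) m₁ , proj₁ (A≐B a₂) m₂ , e ,
  λ b₁ b₂ n₁ n₂ → unique b₁ b₂ (proj₂ (A≐B b₁) n₁) (proj₂ (A≐B b₂) n₂)

Adj-resp-≐ : {A B : Subset r} {x y : F₂^ r} → A ≐ B → Adj A x y → Adj B x y
Adj-resp-≐ {x = x} {y} A≐B (xA , yA , x≢y , d) =
  proj₁ (A≐B x) xA , proj₁ (A≐B y) yA , x≢y , InD-resp-≐ A≐B d

SpanningStar-resp-≐ : {A B : Subset r} {c : F₂^ r} → A ≐ B → SpanningStar A c → SpanningStar B c
SpanningStar-resp-≐ {c = c} A≐B (cA , star) =
  proj₁ (A≐B c) cA ,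
  λ a aB a≢c → Adj-resp-≐ A≐B (star a (proj₂ (A≐B a) aB) a≢c)

SamePair-shift : {g a₁ a₂ b₁ b₂ : F₂^ r} →
  SamePair a₁ a₂ (g ⊕ b₁) (g ⊕ b₂) → SamePair (g ⊕ a₁) (g ⊕ a₂) b₁ b₂
SamePair-shift (inj₁ (p₁ , p₂)) = inj₁ (shift-untranspose p₁ , shift-untranspose p₂)
SamePair-shift (inj₂ (p₁ , p₂)) = inj₂ (shift-untranspose p₁ , shift-untranspose p₂)

InD-shift : {A : Subset r} {x : F₂^ r} (g : F₂^ r) → InD A x → InD (Shift g A) x
InD-shift {A = A} g (a₁ , a₂ , m₁ , m₂ , e , unique) =
  g ⊕ a₁ , g ⊕ a₂ , shift-member A m₁ , shift-member A m₂ ,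
  trans (shift-pair g a₁ a₂) e ,
  λ b₁ b₂ n₁ n₂ eb → SamePair-shift
    (unique (g ⊕ b₁) (g ⊕ b₂) n₁ n₂ (trans (shift-pair g b₁ b₂) eb))

Adj-shift : {A : Subset r} {x y : F₂^ r} (g : F₂^ r) →
  Adj A x y → Adj (Shift g A) (g ⊕ x) (g ⊕ y)
Adj-shift {A = A} {x} {y} g (xA , yA , x≢y , d) =
  shift-member A xA , shift-member A yA , (λ e → x≢y (shift-injective e)) ,
  subst (InD (Shift g A)) (sym (shift-pair g x y)) (InD-shift g d)

SpanningStar-shift : {A : Subset r} {c : F₂^ r} (g : F₂^ r) →
  SpanningStar A c → SpanningStar (Shift g A) (g ⊕ c)
SpanningStar-shift {A = A} {c} g (cA , star) = shift-member A cA , adjacent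
  where
  adjacent : ∀ a → Shift g A a → ¬ (a ≡ g ⊕ c) → Adj (Shift g A) (g ⊕ c) a
  adjacent a aS a≢gc =
    subst (Adj (Shift g A) (g ⊕ c)) (shift-involutive g a)
      (Adj-shift g (star (g ⊕ a) aS (λ e → a≢gc (shift-transpose e))))

star-at-centre⇒star-at-zero : {A : Subset r} (g : F₂^ r) →
  SpanningStar A g → SpanningStar (Shift g A) 𝟎
star-at-centre⇒star-at-zero g star =
  subst (SpanningStar _) (⊕-self g) (SpanningStar-shift g star)

star-at-zero⇒star-at-centre : {A : Subset r} (g : F₂^ r) →
  SpanningStar (Shift g A) 𝟎 → SpanningStar A g
star-at-zero⇒star-at-centre {A = A} g star =
  SpanningStar-resp-≐ (Shift-involutive g A)
    (subst (SpanningStar _) (⊕-identityʳ g) (SpanningStar-shift g star))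

InD-representations-agree : {A : Subset r} {x b₁ b₂ c₁ c₂ : F₂^ r} → InD A x →
  b₁ ∈ A → b₂ ∈ A → b₁ ⊕ b₂ ≡ x → c₁ ∈ A → c₂ ∈ A → c₁ ⊕ c₂ ≡ x →
  SamePair b₁ b₂ c₁ c₂
InD-representations-agree {b₁ = b₁} {b₂} {c₁} {c₂} (_ , _ , _ , _ , _ , unique) m₁ m₂ eb n₁ n₂ ec
  with unique b₁ b₂ m₁ m₂ eb | unique c₁ c₂ n₁ n₂ ec
... | inj₁ (p₁ , p₂) | inj₁ (q₁ , q₂) = inj₁ (trans (sym p₁) q₁ , trans (sym p₂) q₂)
... | inj₁ (p₁ , p₂) | inj₂ (q₁ , q₂) = inj₂ (trans (sym p₁) q₁ , trans (sym p₂) q₂)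
... | inj₂ (p₁ , p₂) | inj₁ (q₁ , q₂) = inj₂ (trans (sym p₂) q₂ , trans (sym p₁) q₁)
... | inj₂ (p₁ , p₂) | inj₂ (q₁ , q₂) = inj₁ (trans (sym p₂) q₂ , trans (sym p₁) q₁)

Punctured : Subset r → Subset r
Punctured B x = x ∈ B × ¬ (x ≡ 𝟎)

-- Centre 0, first half: if 0 is adjacent to every s ∈ B ∖ {0}, then a
-- second representation s = s₁ + s₂ inside B ∖ {0} would have to coincide
-- with s = 0 + s, forcing s₁ = 0 or s₂ = 0.
star-at-zero⇒sumFree : (B : Subset r) → SpanningStar B 𝟎 → SumFree (Punctured B)
star-at-zero⇒sumFree B (zB , star) s (sB , s≢0) (s₁ , s₂ , (B₁ , s₁≢0) , (B₂ , s₂≢0) , e)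
  with star s sB s≢0
... | _ , _ , _ , d
  with InD-representations-agree d zB sB refl B₁ B₂ (trans e (sym (⊕-identityˡ s)))
... | inj₁ (0≡s₁ , _) = s₁≢0 (sym 0≡s₁)
... | inj₂ (0≡s₂ , _) = s₂≢0 (sym 0≡s₂)

-- Centre 0, second half: in S ∪ {0} with S sum-free, s ∈ S has only the
-- representation 0 + s, since a representation avoiding 0 lies in 2S.
sumFree⇒star-at-zero : (S : Subset r) → SumFree S → SpanningStar (WithZero S) 𝟎
sumFree⇒star-at-zero S sumFree = inj₂ refl , adjacent
  where
  unique : ∀ {s} → s ∈ S → ∀ b₁ b₂ → WithZero S b₁ → WithZero S b₂ →
    b₁ ⊕ b₂ ≡ 𝟎 ⊕ s → SamePair 𝟎 s b₁ b₂
  unique sS b₁ b₂ (inj₁ S₁) (inj₁ S₂) e =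
    ⊥-elim (sumFree _ sS (b₁ , b₂ , S₁ , S₂ , trans e (⊕-identityˡ _)))
  unique sS b₁ b₂ (inj₂ refl) _ e =
    inj₁ (refl , sym (trans (sym (⊕-identityˡ b₂)) (trans e (⊕-identityˡ _))))
  unique sS b₁ b₂ _ (inj₂ refl) e =
    inj₂ (refl , sym (trans (sym (⊕-identityʳ b₁)) (trans e (⊕-identityˡ _))))

  adjacent : ∀ a → WithZero S a → ¬ (a ≡ 𝟎) → Adj (WithZero S) 𝟎 a
  adjacent a (inj₂ a≡0) a≢0 = ⊥-elim (a≢0 a≡0)
  adjacent a (inj₁ aS)  a≢0 =
    inj₂ refl , inj₁ aS , (λ e → a≢0 (sym e)) ,
    𝟎 , a , inj₂ refl , inj₁ aS , refl , unique aS

WithZero-Punctured : (B : Subset r) → 𝟎 ∈ B → B ≐ WithZero (Punctured B)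
WithZero-Punctured B zB x = split , merge
  where
  split : x ∈ B → WithZero (Punctured B) x
  split xB with ≡-dec _≟ᴮ_ x 𝟎
  ... | yes x≡0 = inj₂ x≡0
  ... | no  x≢0 = inj₁ (xB , x≢0)
  merge : WithZero (Punctured B) x → x ∈ B
  merge (inj₁ (xB , _)) = xB
  merge (inj₂ refl)     = zB

lemma3p4 : (r : ℕ) → r ≥ 1 → (g : F₂^ r) → (A : Subset r) → AtLeastTwo A →
    SpanningStar A g ⇔ Σ (Subset r) (λ S → SumFree S × (A ≐ Translate g (WithZero S)))
lemma3p4 r _ g A _ = mk⇔ forward backward
  where
  forward : SpanningStar A g → Σ (Subset r) (λ S → SumFree S × (A ≐ Translate g (WithZero S)))
  forward star = Punctured B , star-at-zero⇒sumFree B starB , A≐g+S∪0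
    where
    B : Subset r
    B = Shift g A
    starB : SpanningStar B 𝟎
    starB = star-at-centre⇒star-at-zero g star
    A≐g+S∪0 : A ≐ Translate g (WithZero (Punctured B))
    A≐g+S∪0 =
      ≐-trans (≐-sym (Shift-involutive g A))
      (≐-trans (Shift-resp-≐ g (WithZero-Punctured B (proj₁ starB)))
               (≐-sym (Translate≐Shift g _)))

  backward : Σ (Subset r) (λ S → SumFree S × (A ≐ Translate g (WithZero S))) → SpanningStar A g
  backward (S , sumFree , A≐g+S∪0) =
    star-at-zero⇒star-at-centre g
      (SpanningStar-resp-≐ (≐-sym g+A≐S∪0) (sumFree⇒star-at-zero S sumFree))
    where
    g+A≐S∪0 : Shift g A ≐ WithZero S
    g+A≐S∪0 =
      ≐-trans (Shift-resp-≐ g A≐g+S∪0)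
      (≐-trans (Shift-resp-≐ g (Translate≐Shift g _)) (Shift-involutive g _))
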